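{- For $n\ge0$ let $b_n$ be the number of permutations $\pi$ of $\{1,\dots,n\}$ with $\#132(\pi)=1$ and $\#123(\pi)=3$. Then $$\sum_{n\ge0}b_nz^n=\frac{2z^5(1-z)(5z^2-4z+1)}{(1-2z)^5}.$$
   Context: For a permutation $\pi=\pi_1\cdots\pi_n$, $\#123(\pi)$ is the number of triples $i_1<i_2<i_3$ with $\pi_{i_1}<\pi_{i_2}<\pi_{i_3}$, and $\#132(\pi)$ is the number of triples $i_1<i_2<i_3$ with $\pi_{i_1}<\pi_{i_3}<\pi_{i_2}$. -}

module Defs where

open import Data.Nat using (ℕ; zero; suc)
open import Data.Fin using (Fin; _<_; _<?_)
open import Data.Vec using (Vec; lookup)
open import Data.List using (List; []; _∷_; length; allFin; filter; concatMap; map)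
open import Data.List.Relation.Unary.Unique.Propositional using (Unique)
open import Data.List.Membership.Propositional using (_∈_)
open import Data.Integer as ℤ using (ℤ; +_; -_)
open import Data.Product using (Σ; _×_; _,_)
open import Relation.Binary.PropositionalEquality using (_≡_)
open import Relation.Nullary using (Dec; yes; no; ¬_)
open import Relation.Nullary.Decidable using (_×-dec_)
open import Function.Bundles using (_⇔_)

-- Permutations of an n-element set: a word π = π₀ ⋯ π_{n-1} over Fin n
-- (values 0..n-1 instead of 1..n) whose letters are pairwise distinct.

IsPerm : ∀ {n} → Vec (Fin n) n → Set
IsPerm {n} π = ∀ (i j : Fin n) → lookup π i ≡ lookup π j → i ≡ j

Triple : ℕ → Set
Triple n = Fin n × Fin n × Fin n

allTriples : ∀ n → List (Triple n)
allTriples n =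
  concatMap (λ i → concatMap (λ j → map (λ k → (i , j , k)) (allFin n)) (allFin n)) (allFin n)

Occ123 : ∀ {n} → Vec (Fin n) n → Triple n → Set
Occ123 π (i , j , k) =
  (i < j × j < k) × (lookup π i < lookup π j × lookup π j < lookup π k)

occ123? : ∀ {n} (π : Vec (Fin n) n) (t : Triple n) → Dec (Occ123 π t)
occ123? π (i , j , k) =
  ((i <? j) ×-dec (j <? k)) ×-dec ((lookup π i <? lookup π j) ×-dec (lookup π j <? lookup π k))

Occ132 : ∀ {n} → Vec (Fin n) n → Triple n → Set
Occ132 π (i , j , k) =
  (i < j × j < k) × (lookup π i < lookup π k × lookup π k < lookup π j)

occ132? : ∀ {n} (π : Vec (Fin n) n) (t : Triple n) → Dec (Occ132 π t)
occ132? π (i , j , k) =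
  ((i <? j) ×-dec (j <? k)) ×-dec ((lookup π i <? lookup π k) ×-dec (lookup π k <? lookup π j))

#123 : ∀ {n} → Vec (Fin n) n → ℕ
#123 {n} π = length (filter (occ123? π) (allTriples n))

#132 : ∀ {n} → Vec (Fin n) n → ℕ
#132 {n} π = length (filter (occ132? π) (allTriples n))

HasCard : ∀ {A : Set} → (A → Set) → ℕ → Set
HasCard {A} P k =
  Σ (List A) λ xs → Unique xs × (∀ x → (x ∈ xs) ⇔ P x) × length xs ≡ k

-- Polynomials over ℤ as coefficient lists (constant term first).

Poly : Set
Poly = List ℤ

infixl 6 _⊕_
infixl 7 _⊛_ _·_

_⊕_ : Poly → Poly → Poly
[] ⊕ q = q
(a ∷ p) ⊕ [] = a ∷ p
(a ∷ p) ⊕ (b ∷ q) = (a ℤ.+ b) ∷ (p ⊕ q)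

_·_ : ℤ → Poly → Poly
c · p = map (c ℤ.*_) p

_⊛_ : Poly → Poly → Poly
[] ⊛ q = []
(a ∷ p) ⊛ q = (a · q) ⊕ (+ 0 ∷ (p ⊛ q))

zP : Poly
zP = + 0 ∷ + 1 ∷ []

const : ℤ → Poly
const c = c ∷ []

_^P_ : Poly → ℕ → Poly
p ^P zero = const (+ 1)
p ^P suc m = p ⊛ (p ^P m)

coeff : Poly → ℕ → ℤ
coeff [] _ = + 0
coeff (a ∷ p) zero = a
coeff (a ∷ p) (suc m) = coeff p m

-- n-th coefficient of the formal power series Q(z) · Σ b_n zⁿ:
-- Σ_{k=0}^{n} [z^k]Q · b_{n-k}
mulSeries : Poly → (ℕ → ℕ) → ℕ → ℤ
mulSeries Q b n = go n n
  where
  go : ℕ → ℕ → ℤ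
  go zero m = coeff Q 0 ℤ.* + b m
  go (suc r) m = go r m ℤ.+ coeff Q (suc r) ℤ.* + b (m Data.Nat.∸ suc r)

numer : Poly
numer = const (+ 2) ⊛ (zP ^P 5) ⊛ (const (+ 1) ⊕ (- (+ 1)) · zP)
          ⊛ ((+ 5) · (zP ^P 2) ⊕ (- (+ 4)) · zP ⊕ const (+ 1))

denom : Poly
denom = (const (+ 1) ⊕ (- (+ 2)) · zP) ^P 5

{-# OPTIONS --safe #-}
module Submission where

-- Every permutation of size n + 1 arises uniquely by prepending a value t to a permutation σ
-- of size n and shifting the values ≥ t of σ up by one. The new occurrences of 123 and 132 are
-- exactly the 12- and 21-pairs of σ among its values ≥ t, and there are C(n - t, 2) such pairs
-- together. So as long as #132 ≤ 1 and #123 ≤ 3 only the four largest values can be prepended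
-- (a smaller one creates at least C(4, 2) = 6 occurrences), and the change of (#132, #123)
-- depends only on the relative order of the three largest values of σ. This gives a transfer
-- step on weights over 64 states, and b (3 + k) is the weight of the six permutations of size
-- 3 after k steps. A finite computation shows that the weights after 4, …, 9 steps satisfy the
-- recurrence with characteristic polynomial (x - 2)⁵, so denom · Σ bₙ zⁿ has no terms of
-- degree ≥ 12; its first twelve coefficients are computed directly.

open import Defs
open import Algebra.Properties.CommutativeSemigroup using (interchange)
open import Data.Bool using (Bool; true; false; not; _∧_)
open import Data.Bool.Properties using (∧-zeroʳ)
open import Data.Empty using (⊥-elim)
open import Data.Fin using (Fin; zero; suc; toℕ; fromℕ<; punchIn; punchOut; opposite)
open import Data.Fin.Patterns using (0F; 1F; 2F; 3F)
open import Data.Fin.Properties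
  using (all?; toℕ<n; toℕ≤pred[n]; toℕ-fromℕ<; opposite-prop; opposite-involutive;
         punchIn-injective; punchInᵢ≢i; punchOut-injective; punchIn-punchOut; suc-injective)
open import Data.Integer as ℤ using (ℤ)
import Data.Integer.Properties as ℤ
import Data.Integer.Tactic.RingSolver as ℤ-Solver
open import Data.List
  using (List; []; _∷_; _++_; length; filter; map; concatMap; allFin; tabulate; cartesianProductWith)
open import Data.List.Membership.Propositional using (_∈_)
open import Data.List.Membership.Propositional.Properties
  using (∈-cartesianProductWith⁺; ∈-cartesianProductWith⁻; ∈-allFin; ∈-filter⁺; ∈-filter⁻)
open import Data.List.Properties using (map-++; map-∘; map-cong; map-tabulate)
open import Data.List.Relation.Unary.All using ([])
open import Data.List.Relation.Unary.AllPairs using ([]; _∷_)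
open import Data.List.Relation.Unary.Any using (here; there)
open import Data.List.Relation.Unary.Unique.Propositional using (Unique)
open import Data.List.Relation.Unary.Unique.Propositional.Properties
  using (cartesianProductWith⁺; allFin⁺; filter⁺)
open import Data.Nat
  using (ℕ; zero; suc; _+_; _*_; _∸_; _≤_; _<_; z≤n; s≤s; s≤s⁻¹; _<ᵇ_; _≡ᵇ_; _<?_)
open import Data.Nat.Combinatorics using (_C_; nC1≡n; nCk+nC[k+1]≡[n+1]C[k+1])
open import Data.Nat.GeneralisedArithmetic using (iterate)
open import Data.Nat.ListAction using (sum)
open import Data.Nat.ListAction.Properties using (sum-++)
open import Data.Nat.Properties
  using (_≟_; +-comm; *-identityˡ; +-commutativeSemigroup; +-0-commutativeMonoid;
         ≤-refl; ≤-reflexive; ≤-trans; ≤-<-connex; ≮⇒≥; n≤1+n; m≤m+n; m≤n+m;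
         +-mono-≤; +-monoˡ-≤; +-monoʳ-≤; +-∸-assoc; 0∸n≡0; m+n∸m≡n; m∸[m∸n]≡n;
         [m+n]∸[m+o]≡n∸o; m+n≡0⇒m≡0; m+n≡0⇒n≡0)
import Data.Nat.Tactic.RingSolver as ℕ-Solver
open import Algebra.Properties.CommutativeMonoid.Sum +-0-commutativeMonoid
  using (sum-syntax; ∑-distrib-+)
  renaming (sum-cong-≗ to ∑-cong; sum-replicate-zero to ∑-replicate-zero)
open import Data.Product using (Σ; ∃₂; _×_; _,_)
open import Data.Sum as Sum using (_⊎_; inj₁; inj₂)
open import Data.Vec as Vec using (Vec; []; _∷_; lookup)
open import Data.Vec.Properties
  using (lookup-map; lookup∘tabulate; tabulate∘lookup; tabulate-∘; tabulate-cong; ∷-injective)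
open import Function using (_∘_; _⇔_; mk⇔; Equivalence)
open import Level using (0ℓ)
open import Relation.Binary.PropositionalEquality
open import Relation.Nullary using (Dec; yes; no; does)
open import Relation.Nullary.Decidable using (_×-dec_; toWitness)
open import Relation.Unary using (Pred; Decidable)

open ≡-Reasoning

-- Finite sums

𝟙 : Bool → ℕ
𝟙 true  = 1
𝟙 false = 0

𝟙-not : ∀ b → 𝟙 b + 𝟙 (not b) ≡ 1
𝟙-not true  = refl
𝟙-not false = refl

∑-zero : ∀ {n} {f : Fin n → ℕ} → (∀ i → f i ≡ 0) → ∑[ i < n ] f i ≡ 0
∑-zero {n} f≗0 = trans (∑-cong f≗0) (∑-replicate-zero n)

sum-map-cong : ∀ {A : Set} {f g : A → ℕ} xs → (∀ {x} → x ∈ xs → f x ≡ g x) →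
               sum (map f xs) ≡ sum (map g xs)
sum-map-cong []       f≡g = refl
sum-map-cong (x ∷ xs) f≡g = cong₂ _+_ (f≡g (here refl)) (sum-map-cong xs (f≡g ∘ there))

length-filter : ∀ {A : Set} {P : Pred A 0ℓ} (P? : Decidable P) xs →
                length (filter P? xs) ≡ sum (map (𝟙 ∘ does ∘ P?) xs)
length-filter P? []       = refl
length-filter P? (x ∷ xs) with does (P? x)
... | true  = cong suc (length-filter P? xs)
... | false = length-filter P? xs

sum-map-concatMap : ∀ {A B : Set} (h : B → ℕ) (f : A → List B) xs →
                    sum (map h (concatMap f xs)) ≡ sum (map (λ x → sum (map h (f x))) xs)
sum-map-concatMap h f []       = refl
sum-map-concatMap h f (x ∷ xs) = begin
  sum (map h (f x ++ concatMap f xs))              ≡⟨ cong sum (map-++ h (f x) _) ⟩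
  sum (map h (f x) ++ map h (concatMap f xs))      ≡⟨ sum-++ (map h (f x)) _ ⟩
  sum (map h (f x)) + sum (map h (concatMap f xs))
    ≡⟨ cong (sum (map h (f x)) +_) (sum-map-concatMap h f xs) ⟩
  sum (map h (f x)) + sum (map (λ x → sum (map h (f x))) xs) ∎

sum-tabulate : ∀ n (f : Fin n → ℕ) → sum (tabulate f) ≡ ∑[ i < n ] f i
sum-tabulate zero    f = refl
sum-tabulate (suc n) f = cong (f zero +_) (sum-tabulate n (f ∘ suc))

sum-map-allFin : ∀ n (f : Fin n → ℕ) → sum (map f (allFin n)) ≡ ∑[ i < n ] f i
sum-map-allFin n f = trans (cong sum (map-tabulate (λ i → i) f)) (sum-tabulate n f)

sum-map-concatMap-allFin : ∀ {B : Set} n (h : B → ℕ) (f : Fin n → List B) →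
                           sum (map h (concatMap f (allFin n))) ≡ ∑[ i < n ] sum (map h (f i))
sum-map-concatMap-allFin n h f = trans (sum-map-concatMap h f (allFin n)) (sum-map-allFin n _)

cartesianProductWith≡concatMap : ∀ {A B C : Set} (f : A → B → C) xs ys →
                                 cartesianProductWith f xs ys ≡ concatMap (λ x → map (f x) ys) xs
cartesianProductWith≡concatMap f []       ys = refl
cartesianProductWith≡concatMap f (x ∷ xs) ys =
  cong (map (f x) ys ++_) (cartesianProductWith≡concatMap f xs ys)

sum-map-cartesianProductWith : ∀ {A B C : Set} (h : C → ℕ) (f : A → B → C) xs ys →
  sum (map h (cartesianProductWith f xs ys)) ≡ sum (map (λ x → sum (map (h ∘ f x) ys)) xs)
sum-map-cartesianProductWith h f xs ys = begin
  sum (map h (cartesianProductWith f xs ys))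
    ≡⟨ cong (sum ∘ map h) (cartesianProductWith≡concatMap f xs ys) ⟩
  sum (map h (concatMap (λ x → map (f x) ys) xs))
    ≡⟨ sum-map-concatMap h _ xs ⟩
  sum (map (λ x → sum (map h (map (f x) ys))) xs)
    ≡⟨ cong sum (map-cong (λ x → cong sum (sym (map-∘ ys))) xs) ⟩
  sum (map (λ x → sum (map (h ∘ f x) ys)) xs) ∎

HasCard-filter : ∀ {A : Set} {P Q : Pred A 0ℓ} xs → Unique xs → (∀ x → (x ∈ xs) ⇔ P x) →
                 (Q? : Decidable Q) → HasCard (λ x → P x × Q x) (length (filter Q? xs))
HasCard-filter {P = P} {Q} xs unique enumerates Q? =
  filter Q? xs , filter⁺ Q? unique , membership , refl
  where
  membership : ∀ x → (x ∈ filter Q? xs) ⇔ (P x × Q x)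
  membership x = mk⇔
    (λ x∈ → let (x∈xs , q) = ∈-filter⁻ Q? x∈ in Equivalence.to (enumerates x) x∈xs , q)
    (λ (p , q) → ∈-filter⁺ Q? (Equivalence.from (enumerates x) p) q)

-- Enumerating permutations

_◃_ : ∀ {n} → Fin (suc n) → Vec (Fin n) n → Vec (Fin (suc n)) (suc n)
v ◃ σ = v ∷ Vec.map (punchIn v) σ

-- Prepended values are enumerated from the largest down, so that in the sum over the
-- extensions of σ the four largest values come first.
perms : ∀ n → List (Vec (Fin n) n)
perms zero    = [] ∷ []
perms (suc n) = cartesianProductWith (λ σ i → opposite i ◃ σ) (perms n) (allFin (suc n))

map-punchIn-injective : ∀ {m n} (v : Fin (suc m)) {σ τ : Vec (Fin m) n} →
                        Vec.map (punchIn v) σ ≡ Vec.map (punchIn v) τ → σ ≡ τ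
map-punchIn-injective v {[]}    {[]}    _  = refl
map-punchIn-injective v {x ∷ σ} {y ∷ τ} eq with ∷-injective eq
... | x≡y , σ≡τ = cong₂ _∷_ (punchIn-injective v x y x≡y) (map-punchIn-injective v σ≡τ)

◃-injective : ∀ {n} {v w : Fin (suc n)} {σ τ} → v ◃ σ ≡ w ◃ τ → v ≡ w × σ ≡ τ
◃-injective {v = v} eq with ∷-injective eq
... | refl , eq′ = refl , map-punchIn-injective v eq′

opposite-injective : ∀ {n} {i j : Fin n} → opposite i ≡ opposite j → i ≡ j
opposite-injective {i = i} {j} eq =
  trans (sym (opposite-involutive i)) (trans (cong opposite eq) (opposite-involutive j))

◃-IsPerm : ∀ {n} (v : Fin (suc n)) {σ : Vec (Fin n) n} → IsPerm σ → IsPerm (v ◃ σ)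
◃-IsPerm v {σ} σ-perm zero    zero    eq = refl
◃-IsPerm v {σ} σ-perm zero    (suc j) eq =
  ⊥-elim (punchInᵢ≢i v (lookup σ j) (sym (trans eq (lookup-map j (punchIn v) σ))))
◃-IsPerm v {σ} σ-perm (suc i) zero    eq =
  ⊥-elim (punchInᵢ≢i v (lookup σ i) (trans (sym (lookup-map i (punchIn v) σ)) eq))
◃-IsPerm v {σ} σ-perm (suc i) (suc j) eq = cong suc (σ-perm i j (punchIn-injective v _ _
  (trans (sym (lookup-map i (punchIn v) σ)) (trans eq (lookup-map j (punchIn v) σ)))))

IsPerm-∷ : ∀ {n} {v : Fin (suc n)} {τ : Vec (Fin (suc n)) n} → IsPerm (v ∷ τ) →
           Σ (Vec (Fin n) n) λ σ → IsPerm σ × v ◃ σ ≡ v ∷ τ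
IsPerm-∷ {n} {v} {τ} π-perm = σ , σ-perm , cong (v ∷_) map-punchIn-σ
  where
  v≢ : ∀ j → v ≢ lookup τ j
  v≢ j eq with π-perm zero (suc j) eq
  ... | ()
  σ : Vec (Fin n) n
  σ = Vec.tabulate (λ j → punchOut (v≢ j))
  σ-perm : IsPerm σ
  σ-perm i j eq = suc-injective (π-perm (suc i) (suc j) (punchOut-injective (v≢ i) (v≢ j)
    (trans (sym (lookup∘tabulate _ i)) (trans eq (lookup∘tabulate _ j)))))
  map-punchIn-σ : Vec.map (punchIn v) σ ≡ τ
  map-punchIn-σ = trans (sym (tabulate-∘ (punchIn v) _))
    (trans (tabulate-cong (λ j → punchIn-punchOut (v≢ j))) (tabulate∘lookup τ))

∈-perms⁻ : ∀ {n} {π : Vec (Fin (suc n)) (suc n)} → π ∈ perms (suc n) →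
           ∃₂ λ σ i → σ ∈ perms n × π ≡ opposite i ◃ σ
∈-perms⁻ {n} π∈ with ∈-cartesianProductWith⁻ _ (perms n) (allFin (suc n)) π∈
... | σ , i , σ∈ , _ , π≡ = σ , i , σ∈ , π≡

perms-IsPerm : ∀ {n} {π : Vec (Fin n) n} → π ∈ perms n → IsPerm π
perms-IsPerm {zero}  (here refl) ()
perms-IsPerm {suc n} π∈ with ∈-perms⁻ π∈
... | σ , i , σ∈ , refl = ◃-IsPerm (opposite i) (perms-IsPerm σ∈)

IsPerm⇒∈perms : ∀ {n} {π : Vec (Fin n) n} → IsPerm π → π ∈ perms n
IsPerm⇒∈perms {zero}  {[]}    _      = here refl
IsPerm⇒∈perms {suc n} {v ∷ τ} π-perm with IsPerm-∷ π-perm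
... | σ , σ-perm , v◃σ≡π =
  subst (_∈ perms (suc n)) (trans (cong (_◃ σ) (opposite-involutive v)) v◃σ≡π)
    (∈-cartesianProductWith⁺ (λ σ i → opposite i ◃ σ) (IsPerm⇒∈perms σ-perm) (∈-allFin (opposite v)))

∈-perms⇔IsPerm : ∀ n (π : Vec (Fin n) n) → (π ∈ perms n) ⇔ IsPerm π
∈-perms⇔IsPerm n π = mk⇔ perms-IsPerm IsPerm⇒∈perms

perms-unique : ∀ n → Unique (perms n)
perms-unique zero    = [] ∷ []
perms-unique (suc n) = cartesianProductWith⁺ _ injective (perms-unique n) (allFin⁺ (suc n))
  where
  injective : ∀ {σ τ i j} → opposite i ◃ σ ≡ opposite j ◃ τ → σ ≡ τ × i ≡ j
  injective eq with ◃-injective eq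
  ... | i≡j , σ≡τ = σ≡τ , opposite-injective i≡j

-- Pattern counts and prepending a value

Seq : ℕ → Set
Seq m = Fin m → ℕ

values : ∀ {n} → Vec (Fin n) n → Seq n
values π = toℕ ∘ lookup π

_<ᶠ_ : ∀ {m} → Fin m → Fin m → Bool
i <ᶠ j = toℕ i <ᵇ toℕ j

_≥ᵇ_ : ℕ → ℕ → Bool
y ≥ᵇ s = not (y <ᵇ s)

#indices : ∀ {m} → (Fin m → Bool) → ℕ
#indices {m} p = ∑[ k < m ] 𝟙 (p k)

#pairs : ∀ {m} → (Fin m → Fin m → Bool) → ℕ
#pairs {m} p = ∑[ j < m ] ∑[ k < m ] 𝟙 (j <ᶠ k ∧ p j k)

#triples : ∀ {m} → (Fin m → Fin m → Fin m → Bool) → ℕ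
#triples {m} p = ∑[ i < m ] ∑[ j < m ] ∑[ k < m ] 𝟙 ((i <ᶠ j ∧ j <ᶠ k) ∧ p i j k)

#occurrences : ∀ {m} → (ℕ → ℕ → ℕ → Bool) → Seq m → ℕ
#occurrences R u = #triples λ i j k → R (u i) (u j) (u k)

is123 is132 : ℕ → ℕ → ℕ → Bool
is123 x y z = (x <ᵇ y) ∧ (y <ᵇ z)
is132 x y z = (x <ᵇ z) ∧ (z <ᵇ y)

count-allTriples : ∀ {n} {P : Pred (Triple n) 0ℓ} (P? : Decidable P) →
  length (filter P? (allTriples n)) ≡ ∑[ i < n ] ∑[ j < n ] ∑[ k < n ] 𝟙 (does (P? (i , j , k)))
count-allTriples {n} P? = begin
  length (filter P? (allTriples n))    ≡⟨ length-filter P? (allTriples n) ⟩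
  sum (map h (allTriples n))           ≡⟨ sum-map-concatMap-allFin n h _ ⟩
  ∑[ i < n ] sum (map h (concatMap (λ j → map (λ k → i , j , k) (allFin n)) (allFin n)))
    ≡⟨ ∑-cong {n} (λ i → sum-map-concatMap-allFin n h _) ⟩
  ∑[ i < n ] ∑[ j < n ] sum (map h (map (λ k → i , j , k) (allFin n)))
    ≡⟨ ∑-cong {n} (λ i → ∑-cong {n} λ j →
         trans (cong sum (sym (map-∘ (allFin n)))) (sum-map-allFin n _)) ⟩
  ∑[ i < n ] ∑[ j < n ] ∑[ k < n ] h (i , j , k) ∎
  where
  h : Triple n → ℕ
  h = 𝟙 ∘ does ∘ P?

#123≡#occurrences : ∀ {n} (π : Vec (Fin n) n) → #123 π ≡ #occurrences is123 (values π)
#123≡#occurrences π = count-allTriples (occ123? π)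

#132≡#occurrences : ∀ {n} (π : Vec (Fin n) n) → #132 π ≡ #occurrences is132 (values π)
#132≡#occurrences π = count-allTriples (occ132? π)

#indices-cong : ∀ {m} {p q : Fin m → Bool} → (∀ k → p k ≡ q k) → #indices p ≡ #indices q
#indices-cong {m} eq = ∑-cong {m} (cong 𝟙 ∘ eq)

#pairs-cong : ∀ {m} {p q : Fin m → Fin m → Bool} → (∀ j k → p j k ≡ q j k) →
              #pairs p ≡ #pairs q
#pairs-cong {m} eq = ∑-cong {m} λ j → ∑-cong {m} λ k →
  cong (λ b → 𝟙 (j <ᶠ k ∧ b)) (eq j k)

#triples-cong : ∀ {m} {p q : Fin m → Fin m → Fin m → Bool} → (∀ i j k → p i j k ≡ q i j k) →
                #triples p ≡ #triples q
#triples-cong {m} eq = ∑-cong {m} λ i → ∑-cong {m} λ j → ∑-cong {m} λ k →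
  cong (λ b → 𝟙 ((i <ᶠ j ∧ j <ᶠ k) ∧ b)) (eq i j k)

#indices-zero : ∀ {m} {p : Fin m → Bool} → (∀ k → p k ≡ false) → #indices p ≡ 0
#indices-zero {m} eq = ∑-zero {m} (cong 𝟙 ∘ eq)

#triples-head : ∀ {m} (p : Fin (suc m) → Fin (suc m) → Fin (suc m) → Bool) →
  #triples p ≡ #pairs (λ j k → p zero (suc j) (suc k))
              + #triples (λ i j k → p (suc i) (suc j) (suc k))
#triples-head {m} p =
  cong₂ _+_ (cong₂ _+_ (∑-zero {m} λ _ → refl) refl) (∑-cong {m} other-row)
  where
  other-row : ∀ i → ∑[ j < suc m ] ∑[ k < suc m ] 𝟙 ((suc i <ᶠ j ∧ j <ᶠ k) ∧ p (suc i) j k)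
                  ≡ ∑[ j < m ] ∑[ k < m ] 𝟙 ((i <ᶠ j ∧ j <ᶠ k) ∧ p (suc i) (suc j) (suc k))
  other-row i = cong₂ _+_ (∑-zero {m} λ _ → refl) (∑-cong {m} λ j →
    cong₂ _+_ (cong (λ b → 𝟙 (b ∧ p (suc i) (suc j) zero)) (∧-zeroʳ (i <ᶠ j))) refl)

punchInℕ : ℕ → ℕ → ℕ
punchInℕ zero    y       = suc y
punchInℕ (suc t) zero    = zero
punchInℕ (suc t) (suc y) = suc (punchInℕ t y)

_◂_ : ∀ {m} → ℕ → Seq m → Seq (suc m)
(t ◂ u) zero    = t
(t ◂ u) (suc j) = punchInℕ t (u j)

toℕ-punchIn : ∀ {n} (v : Fin (suc n)) (x : Fin n) → toℕ (punchIn v x) ≡ punchInℕ (toℕ v) (toℕ x)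
toℕ-punchIn zero    x       = refl
toℕ-punchIn (suc v) zero    = refl
toℕ-punchIn (suc v) (suc x) = cong suc (toℕ-punchIn v x)

values-◃ : ∀ {n} (v : Fin (suc n)) (σ : Vec (Fin n) n) → values (v ◃ σ) ≗ toℕ v ◂ values σ
values-◃ v σ zero    = refl
values-◃ v σ (suc j) = trans (cong toℕ (lookup-map j (punchIn v) σ)) (toℕ-punchIn v (lookup σ j))

punchInℕ-<ᵇ : ∀ t x y → (punchInℕ t x <ᵇ punchInℕ t y) ≡ (x <ᵇ y)
punchInℕ-<ᵇ zero    x       y       = refl
punchInℕ-<ᵇ (suc t) zero    zero    = refl
punchInℕ-<ᵇ (suc t) zero    (suc y) = refl
punchInℕ-<ᵇ (suc t) (suc x) zero    = refl
punchInℕ-<ᵇ (suc t) (suc x) (suc y) = punchInℕ-<ᵇ t x y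

<ᵇ-punchInℕ : ∀ t y → (t <ᵇ punchInℕ t y) ≡ (y ≥ᵇ t)
<ᵇ-punchInℕ zero    y       = refl
<ᵇ-punchInℕ (suc t) zero    = refl
<ᵇ-punchInℕ (suc t) (suc y) = <ᵇ-punchInℕ t y

punchInℕ-<ᵇ-self : ∀ t y → (punchInℕ t y <ᵇ t) ≡ (y <ᵇ t)
punchInℕ-<ᵇ-self zero    y       = refl
punchInℕ-<ᵇ-self (suc t) zero    = refl
punchInℕ-<ᵇ-self (suc t) (suc y) = punchInℕ-<ᵇ-self t y

punchInℕ-≥ᵇ : ∀ {s t} y → s ≤ t → (punchInℕ t y ≥ᵇ s) ≡ (y ≥ᵇ s)
punchInℕ-≥ᵇ y       z≤n       = refl
punchInℕ-≥ᵇ zero    (s≤s s≤t) = refl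
punchInℕ-≥ᵇ (suc y) (s≤s s≤t) = punchInℕ-≥ᵇ y s≤t

punchInℕ-≥ᵇ-above : ∀ {s t} y → t ≤ s → (punchInℕ t y ≥ᵇ suc s) ≡ (y ≥ᵇ s)
punchInℕ-≥ᵇ-above y       z≤n       = refl
punchInℕ-≥ᵇ-above zero    (s≤s t≤s) = refl
punchInℕ-≥ᵇ-above (suc y) (s≤s t≤s) = punchInℕ-≥ᵇ-above y t≤s

≥ᵇ-true : ∀ {s t} → s ≤ t → (t ≥ᵇ s) ≡ true
≥ᵇ-true z≤n       = refl
≥ᵇ-true (s≤s s≤t) = ≥ᵇ-true s≤t

≥ᵇ-false : ∀ {s t} → t ≤ s → (t ≥ᵇ suc s) ≡ false
≥ᵇ-false z≤n       = refl
≥ᵇ-false (s≤s t≤s) = ≥ᵇ-false t≤s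

≥ᵇ-∧-<ᵇ : ∀ {s t} y → t ≤ s → ((y ≥ᵇ s) ∧ (y <ᵇ t)) ≡ false
≥ᵇ-∧-<ᵇ y       z≤n       = ∧-zeroʳ _
≥ᵇ-∧-<ᵇ zero    (s≤s t≤s) = refl
≥ᵇ-∧-<ᵇ (suc y) (s≤s t≤s) = ≥ᵇ-∧-<ᵇ y t≤s

𝟙-≥ᵇ-split : ∀ {s t} y → s ≤ t →
              𝟙 (y ≥ᵇ t) + 𝟙 ((y ≥ᵇ s) ∧ (y <ᵇ t)) ≡ 𝟙 (y ≥ᵇ s)
𝟙-≥ᵇ-split {t = t} y z≤n = trans (+-comm (𝟙 (y ≥ᵇ t)) _) (𝟙-not (y <ᵇ t))
𝟙-≥ᵇ-split zero    (s≤s s≤t) = refl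
𝟙-≥ᵇ-split (suc y) (s≤s s≤t) = 𝟙-≥ᵇ-split y s≤t

#≥ : ∀ {m} → ℕ → Seq m → ℕ
#≥ s u = #indices λ k → u k ≥ᵇ s

#between : ∀ {m} → ℕ → ℕ → Seq m → ℕ
#between s t u = #indices λ k → (u k ≥ᵇ s) ∧ (u k <ᵇ t)

#12≥ #21≥ : ∀ {m} → ℕ → Seq m → ℕ
#12≥ s u = #pairs λ j k → (u j ≥ᵇ s) ∧ (u j <ᵇ u k)
#21≥ s u = #pairs λ j k → (u k ≥ᵇ s) ∧ (u k <ᵇ u j)

#≥-head : ∀ {m} s (w : Seq (suc m)) → #≥ s w ≡ 𝟙 (w zero ≥ᵇ s) + #≥ s (w ∘ suc)
#≥-head s w = refl

#12≥-head : ∀ {m} s (w : Seq (suc m)) →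
            #12≥ s w ≡ #indices (λ k → (w zero ≥ᵇ s) ∧ (w zero <ᵇ w (suc k))) + #12≥ s (w ∘ suc)
#12≥-head s w = refl

#21≥-head : ∀ {m} s (w : Seq (suc m)) →
            #21≥ s w ≡ #indices (λ k → (w (suc k) ≥ᵇ s) ∧ (w (suc k) <ᵇ w zero)) + #21≥ s (w ∘ suc)
#21≥-head s w = refl

#occurrences-head : ∀ {m} R (w : Seq (suc m)) →
  #occurrences R w ≡ #pairs (λ j k → R (w zero) (w (suc j)) (w (suc k))) + #occurrences R (w ∘ suc)
#occurrences-head {m} R w = #triples-head {m} λ i j k → R (w i) (w j) (w k)

#≥+#between : ∀ {m s t} (u : Seq m) → s ≤ t → #≥ t u + #between s t u ≡ #≥ s u
#≥+#between {m} u s≤t =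
  trans (sym (∑-distrib-+ {m} _ _)) (∑-cong {m} λ k → 𝟙-≥ᵇ-split (u k) s≤t)

#123-◂ : ∀ {m} t (u : Seq m) → #occurrences is123 (t ◂ u) ≡ #12≥ t u + #occurrences is123 u
#123-◂ t u = trans (#occurrences-head is123 (t ◂ u)) (cong₂ _+_
  (#pairs-cong λ j k → cong₂ _∧_ (<ᵇ-punchInℕ t (u j)) (punchInℕ-<ᵇ t (u j) (u k)))
  (#triples-cong λ i j k → cong₂ _∧_ (punchInℕ-<ᵇ t (u i) (u j)) (punchInℕ-<ᵇ t (u j) (u k))))

#132-◂ : ∀ {m} t (u : Seq m) → #occurrences is132 (t ◂ u) ≡ #21≥ t u + #occurrences is132 u
#132-◂ t u = trans (#occurrences-head is132 (t ◂ u)) (cong₂ _+_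
  (#pairs-cong λ j k → cong₂ _∧_ (<ᵇ-punchInℕ t (u k)) (punchInℕ-<ᵇ t (u k) (u j)))
  (#triples-cong λ i j k → cong₂ _∧_ (punchInℕ-<ᵇ t (u i) (u k)) (punchInℕ-<ᵇ t (u k) (u j))))

module _ {m s t : ℕ} (u : Seq m) where

  #≥-◂ : s ≤ t → #≥ s (t ◂ u) ≡ suc (#≥ s u)
  #≥-◂ s≤t = trans (#≥-head s (t ◂ u)) (cong₂ _+_ (cong 𝟙 (≥ᵇ-true s≤t))
    (#indices-cong λ k → punchInℕ-≥ᵇ (u k) s≤t))

  #≥-◂-above : t ≤ s → #≥ (suc s) (t ◂ u) ≡ #≥ s u
  #≥-◂-above t≤s = trans (#≥-head (suc s) (t ◂ u)) (cong₂ _+_ (cong 𝟙 (≥ᵇ-false t≤s))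
    (#indices-cong λ k → punchInℕ-≥ᵇ-above (u k) t≤s))

  #12≥-◂ : s ≤ t → #12≥ s (t ◂ u) ≡ #≥ t u + #12≥ s u
  #12≥-◂ s≤t = trans (#12≥-head s (t ◂ u)) (cong₂ _+_
    (#indices-cong λ k → cong₂ _∧_ (≥ᵇ-true s≤t) (<ᵇ-punchInℕ t (u k)))
    (#pairs-cong λ j k → cong₂ _∧_ (punchInℕ-≥ᵇ (u j) s≤t) (punchInℕ-<ᵇ t (u j) (u k))))

  #12≥-◂-above : t ≤ s → #12≥ (suc s) (t ◂ u) ≡ #12≥ s u
  #12≥-◂-above t≤s = trans (#12≥-head (suc s) (t ◂ u)) (cong₂ _+_
    (#indices-zero {m} λ k → cong₂ _∧_ (≥ᵇ-false t≤s) refl)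
    (#pairs-cong λ j k → cong₂ _∧_ (punchInℕ-≥ᵇ-above (u j) t≤s) (punchInℕ-<ᵇ t (u j) (u k))))

  #21≥-◂ : s ≤ t → #21≥ s (t ◂ u) ≡ #between s t u + #21≥ s u
  #21≥-◂ s≤t = trans (#21≥-head s (t ◂ u)) (cong₂ _+_
    (#indices-cong λ k → cong₂ _∧_ (punchInℕ-≥ᵇ (u k) s≤t) (punchInℕ-<ᵇ-self t (u k)))
    (#pairs-cong λ j k → cong₂ _∧_ (punchInℕ-≥ᵇ (u k) s≤t) (punchInℕ-<ᵇ t (u k) (u j))))

  #21≥-◂-above : t ≤ s → #21≥ (suc s) (t ◂ u) ≡ #21≥ s u
  #21≥-◂-above t≤s = trans (#21≥-head (suc s) (t ◂ u)) (cong₂ _+_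
    (#indices-zero {m} λ k →
       trans (cong₂ _∧_ (punchInℕ-≥ᵇ-above (u k) t≤s) (punchInℕ-<ᵇ-self t (u k)))
             (≥ᵇ-∧-<ᵇ (u k) t≤s))
    (#pairs-cong λ j k → cong₂ _∧_ (punchInℕ-≥ᵇ-above (u k) t≤s) (punchInℕ-<ᵇ t (u k) (u j))))

record PermCounts {m} (u : Seq m) : Set where
  field
    #≥-count       : ∀ s → #≥ s u ≡ m ∸ s
    #12≥+#21≥-count : ∀ s → #12≥ s u + #21≥ s u ≡ (m ∸ s) C 2

PermCounts-resp : ∀ {m} {u v : Seq m} → u ≗ v → PermCounts u → PermCounts v
PermCounts-resp {u = u} {v} u≗v counts = record
  { #≥-count        = λ s → trans (#indices-cong λ k → cong (_≥ᵇ s) (sym (u≗v k))) (#≥-count s)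
  ; #12≥+#21≥-count = λ s → trans (cong₂ _+_
      (#pairs-cong λ j k → cong₂ (λ x y → (x ≥ᵇ s) ∧ (x <ᵇ y)) (sym (u≗v j)) (sym (u≗v k)))
      (#pairs-cong λ j k → cong₂ (λ x y → (y ≥ᵇ s) ∧ (y <ᵇ x)) (sym (u≗v j)) (sym (u≗v k))))
      (#12≥+#21≥-count s)
  }
  where open PermCounts counts

◂-PermCounts : ∀ {m t} {u : Seq m} → t ≤ m → PermCounts u → PermCounts (t ◂ u)
◂-PermCounts {m} {t} {u} t≤m counts =
  record { #≥-count = #≥-count′ ; #12≥+#21≥-count = #pairs-count′ }
  where
  open PermCounts counts

  suc-∸ : ∀ {s} → s ≤ t → suc m ∸ s ≡ suc (m ∸ s)
  suc-∸ s≤t = +-∸-assoc 1 (≤-trans s≤t t≤m)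

  #≥-count′ : ∀ s → #≥ s (t ◂ u) ≡ suc m ∸ s
  #≥-count′ s with ≤-<-connex s t
  ... | inj₁ s≤t        = trans (#≥-◂ u s≤t) (trans (cong suc (#≥-count s)) (sym (suc-∸ s≤t)))
  ... | inj₂ (s≤s {n = s′} t≤s′) = trans (#≥-◂-above u t≤s′) (#≥-count s′)

  #pairs-count′ : ∀ s → #12≥ s (t ◂ u) + #21≥ s (t ◂ u) ≡ (suc m ∸ s) C 2
  #pairs-count′ s with ≤-<-connex s t
  ... | inj₁ s≤t = begin
    #12≥ s (t ◂ u) + #21≥ s (t ◂ u)
      ≡⟨ cong₂ _+_ (#12≥-◂ u s≤t) (#21≥-◂ u s≤t) ⟩
    (#≥ t u + #12≥ s u) + (#between s t u + #21≥ s u)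
      ≡⟨ interchange +-commutativeSemigroup (#≥ t u) (#12≥ s u) (#between s t u) (#21≥ s u) ⟩
    (#≥ t u + #between s t u) + (#12≥ s u + #21≥ s u)
      ≡⟨ cong₂ _+_ (trans (#≥+#between u s≤t) (#≥-count s)) (#12≥+#21≥-count s) ⟩
    (m ∸ s) + (m ∸ s) C 2
      ≡⟨ cong (_+ (m ∸ s) C 2) (nC1≡n (m ∸ s)) ⟨
    (m ∸ s) C 1 + (m ∸ s) C 2
      ≡⟨ nCk+nC[k+1]≡[n+1]C[k+1] (m ∸ s) 1 ⟩
    suc (m ∸ s) C 2
      ≡⟨ cong (_C 2) (suc-∸ s≤t) ⟨
    (suc m ∸ s) C 2 ∎
  ... | inj₂ (s≤s {n = s′} t≤s′) =
    trans (cong₂ _+_ (#12≥-◂-above u t≤s′) (#21≥-◂-above u t≤s′)) (#12≥+#21≥-count s′)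

perms-PermCounts : ∀ {n} {π : Vec (Fin n) n} → π ∈ perms n → PermCounts (values π)
perms-PermCounts {zero} (here refl) = record
  { #≥-count        = λ s → sym (0∸n≡0 s)
  ; #12≥+#21≥-count = λ s → sym (cong (_C 2) (0∸n≡0 s))
  }
perms-PermCounts {suc n} π∈ with ∈-perms⁻ π∈
... | σ , i , σ∈ , refl = PermCounts-resp (sym ∘ values-◃ (opposite i) σ)
  (◂-PermCounts (toℕ≤pred[n] (opposite i)) (perms-PermCounts σ∈))

-- States and the transfer step

State : Set
State = ℕ × ℕ × ℕ × ℕ

≡-State : ∀ {a a′ b b′ c c′ d d′ : ℕ} → a ≡ a′ → b ≡ b′ → c ≡ c′ → d ≡ d′ →
          _≡_ {A = State} (a , b , c , d) (a′ , b′ , c′ , d′)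
≡-State refl refl refl refl = refl

-- The last two components describe the relative order of the two, resp. three, largest values.
state : ∀ {m} → Seq m → State
state {m} u = #occurrences is132 u , #occurrences is123 u , #12≥ (m ∸ 2) u , #12≥ (m ∸ 3) u

state-resp : ∀ {m} {u v : Seq m} → u ≗ v → state u ≡ state v
state-resp {m} u≗v = ≡-State
  (#triples-cong λ i j k → cong₂ _∧_ (cong₂ _<ᵇ_ (u≗v i) (u≗v k)) (cong₂ _<ᵇ_ (u≗v k) (u≗v j)))
  (#triples-cong λ i j k → cong₂ _∧_ (cong₂ _<ᵇ_ (u≗v i) (u≗v j)) (cong₂ _<ᵇ_ (u≗v j) (u≗v k)))
  (#pairs-cong λ j k → cong₂ _∧_ (cong (_≥ᵇ (m ∸ 2)) (u≗v j)) (cong₂ _<ᵇ_ (u≗v j) (u≗v k)))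
  (#pairs-cong λ j k → cong₂ _∧_ (cong (_≥ᵇ (m ∸ 3)) (u≗v j)) (cong₂ _<ᵇ_ (u≗v j) (u≗v k)))

-- δ r is the effect on the state of prepending the (r + 1)-st largest of the new values.
δ : Fin 4 → State → State
δ 0F (a , b , c , d) = a , b , 0 , c
δ 1F (a , b , c , d) = a , b , 1 , suc c
δ 2F (a , b , c , d) = (1 ∸ c) + a , c + b , c , 2 + c
δ 3F (a , b , c , d) = (3 ∸ d) + a , d + b , c , d

Bounded : State → Set
Bounded (_ , _ , c , d) = c < 2 × d < 4

Escaped : State → Set
Escaped (a , b , _ , _) = 2 ≤ a ⊎ 4 ≤ b

δ-Escaped : ∀ r {x} → Escaped x → Escaped (δ r x)
δ-Escaped 0F e = e
δ-Escaped 1F e = e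
δ-Escaped 2F {a , b , c , d} =
  Sum.map (λ 2≤a → ≤-trans 2≤a (m≤n+m a (1 ∸ c))) (λ 4≤b → ≤-trans 4≤b (m≤n+m b c))
δ-Escaped 3F {a , b , c , d} =
  Sum.map (λ 2≤a → ≤-trans 2≤a (m≤n+m a (3 ∸ d))) (λ 4≤b → ≤-trans 4≤b (m≤n+m b d))

6≤⇒Escaped : ∀ {a b} → 6 ≤ a + b → 2 ≤ a ⊎ 4 ≤ b
6≤⇒Escaped {a} {b} 6≤a+b with ≤-<-connex 2 a
... | inj₁ 2≤a = inj₁ 2≤a
... | inj₂ a<2 = inj₂ (≤-trans (n≤1+n 4) (s≤s⁻¹ (≤-trans 6≤a+b (+-monoˡ-≤ b (s≤s⁻¹ a<2)))))

6≤[4+x]C2 : ∀ x → 6 ≤ (4 + x) C 2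
6≤[4+x]C2 zero    = ≤-refl
6≤[4+x]C2 (suc x) = ≤-trans (6≤[4+x]C2 x)
  (subst ((4 + x) C 2 ≤_) (nCk+nC[k+1]≡[n+1]C[k+1] (4 + x) 1) (m≤n+m _ _))

module Extension {k} {u : Seq (3 + k)} (counts : PermCounts u) where
  open PermCounts counts

  private
    a b c d : ℕ
    a = #occurrences is132 u
    b = #occurrences is123 u
    c = #12≥ (1 + k) u
    d = #12≥ k u

    top-∸ : ∀ r → (3 + k) ∸ (r + k) ≡ 3 ∸ r
    top-∸ r = trans (cong₂ _∸_ (+-comm 3 k) (+-comm r k)) ([m+n]∸[m+o]≡n∸o k 3 r)

    #≥-top : ∀ r → #≥ (r + k) u ≡ 3 ∸ r
    #≥-top r = trans (#≥-count (r + k)) (top-∸ r)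

    pairs-top : ∀ r → #12≥ (r + k) u + #21≥ (r + k) u ≡ (3 ∸ r) C 2
    pairs-top r = trans (#12≥+#21≥-count (r + k)) (cong (_C 2) (top-∸ r))

  bounds : Bounded (state u)
  bounds = s≤s (subst (c ≤_) (pairs-top 1) (m≤m+n c (#21≥ (1 + k) u))) ,
           s≤s (subst (d ≤_) (pairs-top 0) (m≤m+n d (#21≥ k u)))

  state-◂ : ∀ t → state (t ◂ u) ≡
                  (#21≥ t u + a , #12≥ t u + b , #12≥ (2 + k) (t ◂ u) , #12≥ (1 + k) (t ◂ u))
  state-◂ t = ≡-State (#132-◂ t u) (#123-◂ t u) refl refl

  ◂-top : ∀ r → state ((3 + k ∸ toℕ r) ◂ u) ≡ δ r (state u)
  ◂-top 0F = trans (state-◂ (3 + k)) (≡-State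
    (cong (_+ a) (m+n≡0⇒n≡0 (#12≥ (3 + k) u) (pairs-top 3)))
    (cong (_+ b) (m+n≡0⇒m≡0 (#12≥ (3 + k) u) (pairs-top 3)))
    (trans (#12≥-◂ {s = 2 + k} u (+-monoˡ-≤ k (n≤1+n 2)))
           (cong₂ _+_ (#≥-top 3) (m+n≡0⇒m≡0 (#12≥ (2 + k) u) (pairs-top 2))))
    (trans (#12≥-◂ {s = 1 + k} u (+-monoˡ-≤ k {1} {3} (s≤s z≤n))) (cong (_+ c) (#≥-top 3))))
  ◂-top 1F = trans (state-◂ (2 + k)) (≡-State
    (cong (_+ a) (m+n≡0⇒n≡0 (#12≥ (2 + k) u) (pairs-top 2)))
    (cong (_+ b) (m+n≡0⇒m≡0 (#12≥ (2 + k) u) (pairs-top 2)))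
    (trans (#12≥-◂ {s = 2 + k} u ≤-refl)
           (cong₂ _+_ (#≥-top 2) (m+n≡0⇒m≡0 (#12≥ (2 + k) u) (pairs-top 2))))
    (trans (#12≥-◂ {s = 1 + k} u (+-monoˡ-≤ k (n≤1+n 1))) (cong (_+ c) (#≥-top 2))))
  ◂-top 2F = trans (state-◂ (1 + k)) (≡-State
    (cong (_+ a) (trans (sym (m+n∸m≡n c (#21≥ (1 + k) u))) (cong (_∸ c) (pairs-top 1))))
    refl
    (#12≥-◂-above {s = 1 + k} u ≤-refl)
    (trans (#12≥-◂ {s = 1 + k} u ≤-refl) (cong (_+ c) (#≥-top 1))))
  ◂-top 3F = trans (state-◂ k) (≡-State
    (cong (_+ a) (trans (sym (m+n∸m≡n d (#21≥ k u))) (cong (_∸ d) (pairs-top 0))))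
    refl
    (#12≥-◂-above {s = 1 + k} u (n≤1+n k))
    (#12≥-◂-above {s = k} u ≤-refl))

  ◂-low : ∀ {t} x → 3 + k ∸ t ≡ 4 + x → Escaped (state (t ◂ u))
  ◂-low {t} x eq = subst Escaped (sym (state-◂ t)) (6≤⇒Escaped (≤-trans (6≤[4+x]C2 x)
    (≤-trans (≤-reflexive pairs≡) (+-mono-≤ (m≤m+n (#21≥ t u) a) (m≤m+n (#12≥ t u) b)))))
    where
    pairs≡ : (4 + x) C 2 ≡ #21≥ t u + #12≥ t u
    pairs≡ = trans (cong (_C 2) (sym eq))
                   (trans (sym (#12≥+#21≥-count t)) (+-comm (#12≥ t u) (#21≥ t u)))

perms-Bounded : ∀ {k} {π : Vec (Fin (3 + k)) (3 + k)} → π ∈ perms (3 + k) →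
                Bounded (state (values π))
perms-Bounded π∈ = Extension.bounds (perms-PermCounts π∈)

-- Only states in this box can still reach #132 = 1 and #123 = 3; weights vanish outside it.
Box : Set
Box = Fin 2 × Fin 4 × Fin 2 × Fin 4

embed : Box → State
embed (a , b , c , d) = toℕ a , toℕ b , toℕ c , toℕ d

Weights : Set
Weights = Vec (Vec (Vec (Vec ℕ 4) 2) 4) 2

_!_ : Weights → Box → ℕ
w ! (a , b , c , d) = lookup (lookup (lookup (lookup w a) b) c) d

tabulateW : (Box → ℕ) → Weights
tabulateW f =
  Vec.tabulate λ a → Vec.tabulate λ b → Vec.tabulate λ c → Vec.tabulate λ d → f (a , b , c , d)

!-tabulateW : ∀ f y → tabulateW f ! y ≡ f y
!-tabulateW f (a , b , c , d)
  rewrite lookup∘tabulate (λ a → Vec.tabulate λ b → Vec.tabulate λ c → Vec.tabulate λ d →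
                                  f (a , b , c , d)) a
        | lookup∘tabulate (λ b → Vec.tabulate λ c → Vec.tabulate λ d → f (a , b , c , d)) b
        | lookup∘tabulate (λ c → Vec.tabulate λ d → f (a , b , c , d)) c
        = lookup∘tabulate (λ d → f (a , b , c , d)) d

select : ∀ k → ℕ → (Fin k → ℕ) → ℕ
select zero    i       f = 0
select (suc k) zero    f = f zero
select (suc k) (suc i) f = select k i (f ∘ suc)

select-toℕ : ∀ {k} (i : Fin k) f → select k (toℕ i) f ≡ f i
select-toℕ zero    f = refl
select-toℕ (suc i) f = select-toℕ i (f ∘ suc)

select-≥ : ∀ {k i} f → k ≤ i → select k i f ≡ 0
select-≥ f z≤n       = refl
select-≥ f (s≤s k≤i) = select-≥ (f ∘ suc) k≤i

select-0 : ∀ k i {f : Fin k → ℕ} → (∀ j → f j ≡ 0) → select k i f ≡ 0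
select-0 zero    i       f≡0 = refl
select-0 (suc k) zero    f≡0 = f≡0 zero
select-0 (suc k) (suc i) f≡0 = select-0 k i (f≡0 ∘ suc)

weight : Weights → State → ℕ
weight w (a , b , c , d) =
  select 2 a λ a → select 4 b λ b → select 2 c λ c → select 4 d λ d → w ! (a , b , c , d)

weight-embed : ∀ w y → weight w (embed y) ≡ w ! y
weight-embed w (a , b , c , d) =
  trans (select-toℕ a _) (trans (select-toℕ b _) (trans (select-toℕ c _) (select-toℕ d _)))

weight-Escaped : ∀ w x → Escaped x → weight w x ≡ 0
weight-Escaped w _       (inj₁ 2≤a) = select-≥ _ 2≤a
weight-Escaped w (a , _) (inj₂ 4≤b) = select-0 2 a λ _ → select-≥ _ 4≤b

data Located : State → Set where
  inBox   : ∀ a b c d → Located (embed (a , b , c , d))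
  escaped : ∀ {x} → Escaped x → Located x

locate : ∀ x → Bounded x → Located x
locate (a , b , c , d) (c<2 , d<4) with a <? 2 | b <? 4
... | yes a<2 | yes b<4 = subst Located
  (≡-State (toℕ-fromℕ< a<2) (toℕ-fromℕ< b<4) (toℕ-fromℕ< c<2) (toℕ-fromℕ< d<4))
  (inBox (fromℕ< a<2) (fromℕ< b<4) (fromℕ< c<2) (fromℕ< d<4))
... | no a≮2  | _       = escaped (inj₁ (≮⇒≥ a≮2))
... | yes _   | no b≮4  = escaped (inj₂ (≮⇒≥ b≮4))

step : Weights → Weights
step w = tabulateW λ y → ∑[ r < 4 ] weight w (δ r (embed y))

weight-step : ∀ w x → Bounded x → weight (step w) x ≡ ∑[ r < 4 ] weight w (δ r x)
weight-step w x bounded with locate x bounded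
... | inBox a b c d = trans (weight-embed (step w) (a , b , c , d))
                             (!-tabulateW (λ y → ∑[ r < 4 ] weight w (δ r (embed y))) (a , b , c , d))
... | escaped e = trans (weight-Escaped (step w) x e)
                        (sym (∑-zero {4} λ r → weight-Escaped w (δ r x) (δ-Escaped r e)))

target : State → ℕ
target (a , b , _ , _) = 𝟙 ((a ≡ᵇ 1) ∧ (b ≡ᵇ 3))

target-Escaped : ∀ {x} → Escaped x → target x ≡ 0
target-Escaped (inj₁ (s≤s (s≤s _))) = refl
target-Escaped {a , _} (inj₂ (s≤s (s≤s (s≤s (s≤s _))))) = cong 𝟙 (∧-zeroʳ (a ≡ᵇ 1))

start : Weights
start = tabulateW (target ∘ embed)

weight-start : ∀ x → Bounded x → weight start x ≡ target x
weight-start x bounded with locate x bounded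
... | inBox a b c d = trans (weight-embed start (a , b , c , d))
                             (!-tabulateW (target ∘ embed) (a , b , c , d))
... | escaped e     = trans (weight-Escaped start x e) (sym (target-Escaped {x} e))

sumPerms : ℕ → (State → ℕ) → ℕ
sumPerms n g = sum (map (λ π → g (state (values π))) (perms n))

state-◃-opposite : ∀ {n} (i : Fin (suc n)) (σ : Vec (Fin n) n) →
                   state (values (opposite i ◃ σ)) ≡ state ((n ∸ toℕ i) ◂ values σ)
state-◃-opposite i σ =
  trans (state-resp (values-◃ (opposite i) σ))
        (cong (λ t → state (t ◂ values σ)) (opposite-prop i))

sumPerms-step : ∀ k w → sumPerms (4 + k) (weight w) ≡ sumPerms (3 + k) (weight (step w))
sumPerms-step k w = begin
  sumPerms (4 + k) (weight w)
    ≡⟨ sum-map-cartesianProductWith (λ π → weight w (state (values π))) (λ σ i → opposite i ◃ σ)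
                                    (perms (3 + k)) (allFin (4 + k)) ⟩
  sum (map (λ σ → sum (map (λ i → weight w (state (values (opposite i ◃ σ)))) (allFin (4 + k))))
           (perms (3 + k)))
    ≡⟨ sum-map-cong (perms (3 + k)) extensions ⟩
  sumPerms (3 + k) (weight (step w)) ∎
  where
  extensions : ∀ {σ} → σ ∈ perms (3 + k) →
    sum (map (λ i → weight w (state (values (opposite i ◃ σ)))) (allFin (4 + k)))
      ≡ weight (step w) (state (values σ))
  extensions {σ} σ∈ = begin
    sum (map (λ i → weight w (state (values (opposite i ◃ σ)))) (allFin (4 + k)))
      ≡⟨ sum-map-allFin (4 + k) (λ i → weight w (state (values (opposite i ◃ σ)))) ⟩
    ∑[ i < 4 + k ] weight w (state (values (opposite i ◃ σ)))
      ≡⟨ ∑-cong {4 + k} (λ i → cong (weight w) (state-◃-opposite i σ)) ⟩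
    ∑[ i < 4 + k ] weight w (state ((3 + k ∸ toℕ i) ◂ values σ))
      ≡⟨ cong₂ _+_ (top 0F) (cong₂ _+_ (top 1F) (cong₂ _+_ (top 2F)
           (cong₂ _+_ (top 3F) (∑-zero {k} low)))) ⟩
    ∑[ r < 4 ] weight w (δ r (state (values σ)))
      ≡⟨ weight-step w (state (values σ)) (perms-Bounded σ∈) ⟨
    weight (step w) (state (values σ)) ∎
    where
    open Extension (perms-PermCounts σ∈)
    top : ∀ r → weight w (state ((3 + k ∸ toℕ r) ◂ values σ)) ≡ weight w (δ r (state (values σ)))
    top r = cong (weight w) (◂-top r)
    low : ∀ j → weight w (state ((3 + k ∸ (4 + toℕ j)) ◂ values σ)) ≡ 0
    low j = weight-Escaped w (state (t ◂ values σ))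
                           (◂-low {t} (toℕ j) (m∸[m∸n]≡n (+-monoʳ-≤ 3 (toℕ<n j))))
      where t = 3 + k ∸ (4 + toℕ j)

sumPerms-iterate : ∀ k w → sumPerms (3 + k) (weight w) ≡ sumPerms 3 (weight (iterate step w k))
sumPerms-iterate zero    w = refl
sumPerms-iterate (suc k) w = trans (sumPerms-step k w) (sumPerms-iterate k (step w))

b : ℕ → ℕ
b 0                     = 0
b 1                     = 0
b 2                     = 0
b (suc (suc (suc k)))   = sumPerms 3 (weight (iterate step start k))

target? : ∀ {n} (π : Vec (Fin n) n) → Dec (#132 π ≡ 1 × #123 π ≡ 3)
target? π = (#132 π ≟ 1) ×-dec (#123 π ≟ 3)

length-filter-perms : ∀ n → length (filter target? (perms n)) ≡ b n
length-filter-perms 0                   = refl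
length-filter-perms 1                   = refl
length-filter-perms 2                   = refl
length-filter-perms (suc (suc (suc k))) = begin
  length (filter target? (perms (3 + k)))           ≡⟨ length-filter target? (perms (3 + k)) ⟩
  sum (map (𝟙 ∘ does ∘ target?) (perms (3 + k)))    ≡⟨ sum-map-cong (perms (3 + k)) indicator ⟩
  sumPerms (3 + k) (weight start)                      ≡⟨ sumPerms-iterate k start ⟩
  b (3 + k)                                            ∎
  where
  indicator : ∀ {π} → π ∈ perms (3 + k) →
              𝟙 (does (target? π)) ≡ weight start (state (values π))
  indicator {π} π∈ = begin
    𝟙 ((#132 π ≡ᵇ 1) ∧ (#123 π ≡ᵇ 3))
      ≡⟨ cong₂ (λ p q → 𝟙 ((p ≡ᵇ 1) ∧ (q ≡ᵇ 3))) (#132≡#occurrences π) (#123≡#occurrences π) ⟩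
    target (state (values π))
      ≡⟨ weight-start (state (values π)) (perms-Bounded π∈) ⟨
    weight start (state (values π)) ∎

-- The recurrence

-- F₅ - 10 F₄ + 40 F₃ - 80 F₂ + 80 F₁ - 32 F₀ = 0, the recurrence with characteristic
-- polynomial (x - 2)⁵, with the negative terms moved to the right.
Annihilated : (ℕ → ℕ) → Set
Annihilated F = F 5 + 40 * F 3 + 80 * F 1 ≡ 10 * F 4 + 80 * F 2 + 32 * F 0

Annihilated-cong : ∀ {F G} → (∀ r → F r ≡ G r) → Annihilated F → Annihilated G
Annihilated-cong {F} {G} F≗G annihilated = begin
  G 5 + 40 * G 3 + 80 * G 1
    ≡⟨ cong₂ _+_ (cong₂ _+_ (F≗G 5) (cong (40 *_) (F≗G 3))) (cong (80 *_) (F≗G 1)) ⟨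
  F 5 + 40 * F 3 + 80 * F 1
    ≡⟨ annihilated ⟩
  10 * F 4 + 80 * F 2 + 32 * F 0
    ≡⟨ cong₂ _+_ (cong₂ _+_ (cong (10 *_) (F≗G 4)) (cong (80 *_) (F≗G 2))) (cong (32 *_) (F≗G 0)) ⟩
  10 * G 4 + 80 * G 2 + 32 * G 0 ∎

Annihilated-+ : ∀ {F G} → Annihilated F → Annihilated G → Annihilated (λ r → F r + G r)
Annihilated-+ {F} {G} annihilatedF annihilatedG = begin
  (F 5 + G 5) + 40 * (F 3 + G 3) + 80 * (F 1 + G 1)
    ≡⟨ left (F 5) (F 3) (F 1) (G 5) (G 3) (G 1) ⟩
  (F 5 + 40 * F 3 + 80 * F 1) + (G 5 + 40 * G 3 + 80 * G 1)
    ≡⟨ cong₂ _+_ annihilatedF annihilatedG ⟩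
  (10 * F 4 + 80 * F 2 + 32 * F 0) + (10 * G 4 + 80 * G 2 + 32 * G 0)
    ≡⟨ right (F 4) (F 2) (F 0) (G 4) (G 2) (G 0) ⟨
  10 * (F 4 + G 4) + 80 * (F 2 + G 2) + 32 * (F 0 + G 0) ∎
  where
  left : ∀ x y z x′ y′ z′ →
         (x + x′) + 40 * (y + y′) + 80 * (z + z′) ≡ (x + 40 * y + 80 * z) + (x′ + 40 * y′ + 80 * z′)
  left = ℕ-Solver.solve-∀
  right : ∀ x y z x′ y′ z′ →
          10 * (x + x′) + 80 * (y + y′) + 32 * (z + z′)
          ≡ (10 * x + 80 * y + 32 * z) + (10 * x′ + 80 * y′ + 32 * z′)
  right = ℕ-Solver.solve-∀

Annihilated-sum : ∀ {A : Set} (F : ℕ → A → ℕ) xs →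
                  (∀ {x} → x ∈ xs → Annihilated (λ r → F r x)) →
                  Annihilated (λ r → sum (map (F r) xs))
Annihilated-sum F []       _           = refl
Annihilated-sum F (x ∷ xs) annihilated =
  Annihilated-+ {λ r → F r x} {λ r → sum (map (F r) xs)}
    (annihilated (here refl)) (Annihilated-sum F xs (annihilated ∘ there))

annihilated? : ∀ F → Dec (Annihilated F)
annihilated? F = _ ≟ _

steps : ℕ → Weights
steps = iterate step start

box-annihilated : ∀ a b c d → Annihilated (λ r → steps (4 + r) ! (a , b , c , d))
box-annihilated = toWitness {a? = all? λ a → all? λ b → all? λ c → all? λ d →
                                   annihilated? (λ r → steps (4 + r) ! (a , b , c , d))} _

weight-annihilated : ∀ x → Bounded x → Annihilated (λ r → weight (steps (4 + r)) x)
weight-annihilated x bounded = annihilated (locate x bounded)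
  where
  annihilated : ∀ {x} → Located x → Annihilated (λ r → weight (steps (4 + r)) x)
  annihilated (inBox a b c d) = Annihilated-cong {λ r → steps (4 + r) ! (a , b , c , d)}
    (λ r → sym (weight-embed (steps (4 + r)) (a , b , c , d))) (box-annihilated a b c d)
  annihilated {x} (escaped e) =
    Annihilated-cong {λ _ → 0} (λ r → sym (weight-Escaped (steps (4 + r)) x e)) refl

iterate-+ : ∀ {A : Set} (f : A → A) x r j → iterate f x (r + j) ≡ iterate f (iterate f x r) j
iterate-+ f x zero    j = refl
iterate-+ f x (suc r) j = iterate-+ f (f x) r j

perms-weight-annihilated : ∀ {k} {π : Vec (Fin (3 + k)) (3 + k)} → π ∈ perms (3 + k) →
                           Annihilated (λ r → weight (steps (4 + r)) (state (values π)))
perms-weight-annihilated {π = π} π∈ = weight-annihilated (state (values π)) (perms-Bounded π∈)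

b-annihilated : ∀ j → Annihilated (λ r → b (7 + r + j))
b-annihilated j = Annihilated-cong {F} {λ r → b (7 + r + j)} shift summed
  where
  F : ℕ → ℕ
  F r = sum (map (λ π → weight (steps (4 + r)) (state (values π))) (perms (3 + j)))
  summed : Annihilated F
  summed = Annihilated-sum (λ r π → weight (steps (4 + r)) (state (values π))) (perms (3 + j))
    perms-weight-annihilated
  shift : ∀ r → F r ≡ b (7 + r + j)
  shift r = trans (sumPerms-iterate j (steps (4 + r)))
                  (cong (sumPerms 3 ∘ weight) (sym (iterate-+ step start (4 + r) j)))

-- The generating function

-- mulSeries sums through a helper local to its definition, which cannot be referred to;
-- unification recovers it from the unfolding below.
mutual
  denomTerm : (ℕ → ℕ) → ℕ → ℕ → ℕ → ℤ
  denomTerm = _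

  mulSeries-denom : ∀ f k → mulSeries denom f (suc k) ≡ denomTerm f k (suc k) (k ∸ k)
  mulSeries-denom f k with suc k | k ∸ k
  ... | n | z = refl

-- Σ_{i ≤ r + 1} [zⁱ] denom · f (n - i)
denomPartial : (ℕ → ℕ) → ℕ → ℕ → ℤ
denomPartial f r n = denomTerm f r n (n ∸ suc r)

denomPartial-stable : ∀ f r n → denomPartial f (4 + r) n ≡ denomPartial f 4 n
denomPartial-stable f zero    n = refl
denomPartial-stable f (suc r) n = trans (ℤ.+-identityʳ _) (denomPartial-stable f r n)

pos-linear : ∀ p q r x y z →
             ℤ.+ (p * x + q * y + r * z) ≡ ℤ.+ p ℤ.* ℤ.+ x ℤ.+ ℤ.+ q ℤ.* ℤ.+ y ℤ.+ ℤ.+ r ℤ.* ℤ.+ z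
pos-linear p q r x y z = trans (ℤ.pos-+ (p * x + q * y) (r * z))
  (cong₂ ℤ._+_ (trans (ℤ.pos-+ (p * x) (q * y)) (cong₂ ℤ._+_ (ℤ.pos-* p x) (ℤ.pos-* q y)))
               (ℤ.pos-* r z))

denomPartial-annihilated : ∀ f j → Annihilated (λ r → f (7 + r + j)) →
                           denomPartial f 4 (12 + j) ≡ ℤ.+ 0
denomPartial-annihilated f j annihilated = begin
  denomPartial f 4 (12 + j)
    ≡⟨ regroup (ℤ.+ F 5) (ℤ.+ F 4) (ℤ.+ F 3) (ℤ.+ F 2) (ℤ.+ F 1) (ℤ.+ F 0) ⟩
  (ℤ.+ 1 ℤ.* ℤ.+ F 5 ℤ.+ ℤ.+ 40 ℤ.* ℤ.+ F 3 ℤ.+ ℤ.+ 80 ℤ.* ℤ.+ F 1)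
    ℤ.- (ℤ.+ 10 ℤ.* ℤ.+ F 4 ℤ.+ ℤ.+ 80 ℤ.* ℤ.+ F 2 ℤ.+ ℤ.+ 32 ℤ.* ℤ.+ F 0)
    ≡⟨ cong₂ ℤ._-_ (pos-linear 1 40 80 (F 5) (F 3) (F 1)) (pos-linear 10 80 32 (F 4) (F 2) (F 0)) ⟨
  ℤ.+ (1 * F 5 + 40 * F 3 + 80 * F 1) ℤ.- ℤ.+ R
    ≡⟨ cong (λ n → ℤ.+ n ℤ.- ℤ.+ R)
            (trans (cong (λ x → x + 40 * F 3 + 80 * F 1) (*-identityˡ (F 5))) annihilated) ⟩
  ℤ.+ R ℤ.- ℤ.+ R
    ≡⟨ ℤ.+-inverseʳ (ℤ.+ R) ⟩
  ℤ.+ 0 ∎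
  where
  F : ℕ → ℕ
  F r = f (7 + r + j)
  R : ℕ
  R = 10 * F 4 + 80 * F 2 + 32 * F 0
  regroup : ∀ a b c d e g →
    ℤ.+ 1 ℤ.* a ℤ.+ ℤ.- ℤ.+ 10 ℤ.* b ℤ.+ ℤ.+ 40 ℤ.* c
      ℤ.+ ℤ.- ℤ.+ 80 ℤ.* d ℤ.+ ℤ.+ 80 ℤ.* e ℤ.+ ℤ.- ℤ.+ 32 ℤ.* g
    ≡ (ℤ.+ 1 ℤ.* a ℤ.+ ℤ.+ 40 ℤ.* c ℤ.+ ℤ.+ 80 ℤ.* e)
      ℤ.- (ℤ.+ 10 ℤ.* b ℤ.+ ℤ.+ 80 ℤ.* d ℤ.+ ℤ.+ 32 ℤ.* g)
  regroup = ℤ-Solver.solve-∀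

b-generatingFunction : ∀ n → mulSeries denom b n ≡ coeff numer n
b-generatingFunction 0  = refl
b-generatingFunction 1  = refl
b-generatingFunction 2  = refl
b-generatingFunction 3  = refl
b-generatingFunction 4  = refl
b-generatingFunction 5  = refl
b-generatingFunction 6  = refl
b-generatingFunction 7  = refl
b-generatingFunction 8  = refl
b-generatingFunction 9  = refl
b-generatingFunction 10 = refl
b-generatingFunction 11 = refl
b-generatingFunction (suc (suc (suc (suc (suc (suc (suc (suc (suc (suc (suc (suc j)))))))))))) = begin
  mulSeries denom b (12 + j)          ≡⟨ mulSeries-denom b (11 + j) ⟩
  denomPartial b (11 + j) (12 + j)    ≡⟨ denomPartial-stable b (7 + j) (12 + j) ⟩
  denomPartial b 4 (12 + j)           ≡⟨ denomPartial-annihilated b j (b-annihilated j) ⟩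
  ℤ.+ 0                               ∎

mainTheorem8 : Σ (ℕ → ℕ) λ b →
    (∀ n → HasCard (λ (π : Vec (Fin n) n) → IsPerm π × #132 π ≡ 1 × #123 π ≡ 3) (b n))
    × (∀ n → mulSeries denom b n ≡ coeff numer n)
mainTheorem8 = b , hasCard , b-generatingFunction
  where
  hasCard : ∀ n → HasCard (λ (π : Vec (Fin n) n) → IsPerm π × #132 π ≡ 1 × #123 π ≡ 3) (b n)
  hasCard n = subst (HasCard _) (length-filter-perms n)
    (HasCard-filter (perms n) (perms-unique n) (∈-perms⇔IsPerm n) target?)
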